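{- Let $K$ be a commutative ring with unity, $v,w:\mathbb Z\to K$, and $\alpha,\beta\in\mathbb Z$. With the $\mathcal V$-Stirling numbers as defined in the context, for all integers $m_1,m_2,n\ge 0$, $$c^{\mathcal V}_{\alpha,\beta}[m_1+m_2,n]=\sum_{k=0}^{n}c^{\mathcal V}_{\alpha+m_2,\beta}[m_1,n-k]\,c^{\mathcal V}_{\alpha,\beta+m_1}[m_2,k],$$ $$S^{\mathcal V}_{\alpha,\beta}[m_1+m_2,n]=\sum_{k=0}^{n}S^{\mathcal V}_{\alpha+k,\beta}[m_1,n-k]\,S^{\mathcal V}_{\alpha,\beta+n-k}[m_2,k].$$
   Context: Let $K$ be a commutative ring with unity and $v,w:\mathbb Z\to K$ functions; write $v_i=v(i)$, $w_i=w(i)$ and $\mathcal V=(v,w)$. For finitely many variables, $e_t$ denotes the $t$-th elementary symmetric function and $h_t$ the $t$-th complete homogeneous symmetric function, with $e_0=h_0=1$ and $e_t=h_t=0$ for $t<0$ (and $e_t=0$ when $t$ exceeds the number of variables). For $\alpha,\beta\in\mathbb Z$ and integers $n,k\ge 0$ define $$c^{\mathcal V}_{\alpha,\beta}[n,k]=e_{n-k}\big(v_{\alpha+n-1}w_{\beta},v_{\alpha+n-2}w_{\beta+1},\ldots,v_{\alpha}w_{\beta+n-1}\big)$$ (the $n$ arguments $v_{\alpha+n-1-i}w_{\beta+i}$, $0\le i\le n-1$), and $$S^{\mathcal V}_{\alpha,\beta}[n,k]=h_{n-k}\big(v_{\alpha+k}w_{\beta},v_{\alpha+k-1}w_{\beta+1},\ldots,v_{\alpha}w_{\beta+k}\big)$$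 (the $k+1$ arguments $v_{\alpha+k-i}w_{\beta+i}$, $0\le i\le k$). In particular both vanish when $k>n$. If $n<0$ or $k<0$, both are defined to be $0$. -}

module Defs where

open import Level using (Level)
open import Algebra.Bundles using (CommutativeRing)
open import Data.Nat as ℕ using (ℕ; zero; suc; _∸_; _≤?_)
open import Data.Integer as ℤ using (ℤ; +_)
open import Data.List using (List; []; _∷_; map; upTo; reverse)
open import Relation.Nullary using (yes; no)

module VStirling {c ℓ : Level} (K : CommutativeRing c ℓ) where
  open CommutativeRing K using (Carrier; _+_; _*_; 0#; 1#)

  elem : ℕ → List Carrier → Carrier
  elem zero    _        = 1#
  elem (suc t) []       = 0#
  elem (suc t) (x ∷ xs) = elem (suc t) xs + x * elem t xs

  comp : ℕ → List Carrier → Carrier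
  comp zero    _        = 1#
  comp (suc t) []       = 0#
  comp (suc t) (x ∷ xs) = comp (suc t) xs + x * comp t (x ∷ xs)

  sumTo : ℕ → (ℕ → Carrier) → Carrier
  sumTo zero    f = f zero
  sumTo (suc n) f = sumTo n f + f (suc n)

  module _ (v w : ℤ → Carrier) where

    cArgs : ℤ → ℤ → ℕ → List Carrier
    cArgs α β n = map (λ i → v (α ℤ.+ (+ n) ℤ.- (+ 1) ℤ.- (+ i)) * w (β ℤ.+ (+ i))) (upTo n)

    SArgs : ℤ → ℤ → ℕ → List Carrier
    SArgs α β k = map (λ i → v (α ℤ.+ (+ k) ℤ.- (+ i)) * w (β ℤ.+ (+ i))) (upTo (suc k))

    cV : ℤ → ℤ → ℕ → ℕ → Carrier
    cV α β n k with k ≤? n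
    ... | yes _ = elem (n ∸ k) (cArgs α β n)
    ... | no  _ = 0#

    SV : ℤ → ℤ → ℕ → ℕ → Carrier
    SV α β n k with k ≤? n
    ... | yes _ = comp (n ∸ k) (SArgs α β k)
    ... | no  _ = 0#

module Submission where

-- Both identities hold for *generic* weight sequences g : ℕ → K.  Let
--   cGen g N k = e_{N-k}(g 0, …, g (N-1)),   SGen g N k = h_{N-k}(g 0, …, g k)
-- (both 0 for k > N), defined by the Pascal-type recurrences obtained by
-- expanding in the variable g 0.  By induction on m₁:
--   cGen g (m₁+m₂) n = Σ_k cGen g m₁ (n-k) · cGen (g shifted by m₁) m₂ k,
--   SGen g (m₁+m₂) n = Σ_j SGen g m₁ j · SGen (g shifted by j) m₂ (n-j).

open import Defs
open import Level using (Level)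
open import Algebra.Bundles using (CommutativeRing)
open import Data.Nat as ℕ using (ℕ; zero; suc; _∸_; _≤_; _<_; z≤n; s≤s; _≤?_)
import Data.Nat.Properties as ℕP
open import Data.Integer as ℤ using (ℤ; +_)
import Data.Integer.Properties as ℤP
open import Data.Integer.Tactic.RingSolver using (solve-∀)
open import Data.List using ([]; _∷_; length; applyUpTo)
import Data.List.Properties as ListP
open import Data.Product using (_×_; _,_)
open import Function using (_∘_)
import Relation.Binary.PropositionalEquality as ≡
open import Relation.Binary.PropositionalEquality using (_≡_)
import Relation.Binary.Reasoning.Setoid as SetoidReasoning
open import Relation.Nullary using (yes; no)

module StirlingConvolution {c ℓ : Level} (K : CommutativeRing c ℓ) where
  open CommutativeRing K hiding (zero)
  open VStirling K
  open SetoidReasoning setoid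
  open import Algebra.Solver.Ring.NaturalCoefficients.Default commutativeSemiring

  +-*-vanishing : ∀ {x x′ z} y → x ≈ x′ → z ≈ 0# → x + y * z ≈ x′
  +-*-vanishing y x≈x′ z≈0 = trans (+-cong x≈x′ (trans (*-congˡ z≈0) (zeroʳ y))) (+-identityʳ _)

  sumTo-cong : ∀ n {f g : ℕ → Carrier} → (∀ k → k ≤ n → f k ≈ g k) → sumTo n f ≈ sumTo n g
  sumTo-cong zero    f≈g = f≈g 0 z≤n
  sumTo-cong (suc n) f≈g =
    +-cong (sumTo-cong n (λ k k≤n → f≈g k (ℕP.m≤n⇒m≤1+n k≤n))) (f≈g (suc n) ℕP.≤-refl)

  sumTo-linear : ∀ n a (f g : ℕ → Carrier) →
                 sumTo n f + a * sumTo n g ≈ sumTo n (λ k → f k + a * g k)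
  sumTo-linear zero    a f g = refl
  sumTo-linear (suc n) a f g = begin
    (sumTo n f + f (suc n)) + a * (sumTo n g + g (suc n))
      ≈⟨ solve 5 (λ S x a T y → (S :+ x) :+ a :* (T :+ y) := (S :+ a :* T) :+ (x :+ a :* y))
               refl (sumTo n f) (f (suc n)) a (sumTo n g) (g (suc n)) ⟩
    (sumTo n f + a * sumTo n g) + (f (suc n) + a * g (suc n))
      ≈⟨ +-congʳ (sumTo-linear n a f g) ⟩
    sumTo (suc n) (λ k → f k + a * g k) ∎

  sumTo-head : ∀ n (f : ℕ → Carrier) → sumTo (suc n) f ≈ f 0 + sumTo n (f ∘ suc)
  sumTo-head zero    f = refl
  sumTo-head (suc n) f = trans (+-congʳ (sumTo-head n f)) (+-assoc _ _ _)

  sumTo-reverse : ∀ n (f : ℕ → Carrier) → sumTo n f ≈ sumTo n (λ k → f (n ∸ k))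
  sumTo-reverse zero    f = refl
  sumTo-reverse (suc n) f = begin
    sumTo n f + f (suc n)                  ≈⟨ +-congʳ (sumTo-reverse n f) ⟩
    sumTo n (λ k → f (n ∸ k)) + f (suc n)  ≈⟨ +-comm _ _ ⟩
    f (suc n) + sumTo n (λ k → f (n ∸ k))  ≈⟨ sumTo-head n (λ k → f (suc n ∸ k)) ⟨
    sumTo (suc n) (λ k → f (suc n ∸ k))    ∎

  sumTo-last : ∀ n (f : ℕ → Carrier) → (∀ k → k < n → f k ≈ 0#) → sumTo n f ≈ f n
  sumTo-last zero    f _     = refl
  sumTo-last (suc n) f below = begin
    sumTo n f + f (suc n)  ≈⟨ +-congʳ (sumTo-last n f (λ k k<n → below k (ℕP.m<n⇒m<1+n k<n))) ⟩
    f n + f (suc n)        ≈⟨ +-congʳ (below n ℕP.≤-refl) ⟩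
    0# + f (suc n)         ≈⟨ +-identityˡ _ ⟩
    f (suc n)              ∎

  sumTo-first : ∀ n (f : ℕ → Carrier) → (∀ k → k < n → f (suc k) ≈ 0#) → sumTo n f ≈ f 0
  sumTo-first zero    f _     = refl
  sumTo-first (suc n) f above = begin
    sumTo n f + f (suc n)
      ≈⟨ +-cong (sumTo-first n f (λ k k<n → above k (ℕP.m<n⇒m<1+n k<n))) (above n ℕP.≤-refl) ⟩
    f 0 + 0#  ≈⟨ +-identityʳ _ ⟩
    f 0       ∎

  shift : ℕ → (ℕ → Carrier) → ℕ → Carrier
  shift m g i = g (m ℕ.+ i)

  -- cGen g N k = e_{N-k}(g 0, …, g (N-1)), and 0 for k > N; the recurrence is
  -- e_d(x, ys) = e_d(ys) + x · e_{d-1}(ys) read at lower index k = N - d.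
  cGen : (ℕ → Carrier) → ℕ → ℕ → Carrier
  cGen g zero    zero    = 1#
  cGen g zero    (suc k) = 0#
  cGen g (suc N) zero    = g 0 * cGen (g ∘ suc) N zero
  cGen g (suc N) (suc k) = cGen (g ∘ suc) N k + g 0 * cGen (g ∘ suc) N (suc k)

  cGen-cong : ∀ {f g} → (∀ i → f i ≈ g i) → ∀ N k → cGen f N k ≈ cGen g N k
  cGen-cong f≈g zero    zero    = refl
  cGen-cong f≈g zero    (suc k) = refl
  cGen-cong f≈g (suc N) zero    = *-cong (f≈g 0) (cGen-cong (f≈g ∘ suc) N zero)
  cGen-cong f≈g (suc N) (suc k) =
    +-cong (cGen-cong (f≈g ∘ suc) N k) (*-cong (f≈g 0) (cGen-cong (f≈g ∘ suc) N (suc k)))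

  cGen-vanish : ∀ g {N k} → N < k → cGen g N k ≈ 0#
  cGen-vanish g {zero}  {suc k} _         = refl
  cGen-vanish g {suc N} {suc k} (s≤s N<k) =
    +-*-vanishing (g 0) (cGen-vanish (g ∘ suc) N<k) (cGen-vanish (g ∘ suc) (ℕP.m<n⇒m<1+n N<k))

  -- Splitting the N = m₁ + m₂ variables into the first m₁ and the last m₂.
  cGen-convolution : ∀ g m₁ m₂ n →
    cGen g (m₁ ℕ.+ m₂) n ≈ sumTo n (λ k → cGen g m₁ (n ∸ k) * cGen (shift m₁ g) m₂ k)
  cGen-convolution g zero m₂ n = sym (begin
    sumTo n (λ k → cGen g 0 (n ∸ k) * cGen g m₂ k)
      ≈⟨ sumTo-last n _ (λ k k<n → trans (*-congʳ (cGen-vanish g (ℕP.m<n⇒0<n∸m k<n))) (zeroˡ _)) ⟩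
    cGen g 0 (n ∸ n) * cGen g m₂ n  ≈⟨ *-congʳ (reflexive (≡.cong (cGen g 0) (ℕP.n∸n≡0 n))) ⟩
    1# * cGen g m₂ n                ≈⟨ *-identityˡ _ ⟩
    cGen g m₂ n                     ∎)
  cGen-convolution g (suc m₁) m₂ zero =
    trans (*-congˡ (cGen-convolution (g ∘ suc) m₁ m₂ zero)) (sym (*-assoc _ _ _))
  cGen-convolution g (suc m₁) m₂ (suc n) = begin
    cGen g′ (m₁ ℕ.+ m₂) n + g 0 * cGen g′ (m₁ ℕ.+ m₂) (suc n)
      ≈⟨ +-cong (cGen-convolution g′ m₁ m₂ n) (*-congˡ (cGen-convolution g′ m₁ m₂ (suc n))) ⟩
    sumTo n (λ k → A k * E k) + g 0 * (sumTo n (λ k → B k * E k) + B (suc n) * E (suc n))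
      ≈⟨ solve 4 (λ S x T y → S :+ x :* (T :+ y) := (S :+ x :* T) :+ x :* y)
               refl (sumTo n (λ k → A k * E k)) (g 0) (sumTo n (λ k → B k * E k)) (B (suc n) * E (suc n)) ⟩
    (sumTo n (λ k → A k * E k) + g 0 * sumTo n (λ k → B k * E k)) + g 0 * (B (suc n) * E (suc n))
      ≈⟨ +-cong (sumTo-linear n (g 0) _ _) lastTerm ⟩
    sumTo n (λ k → A k * E k + g 0 * (B k * E k)) + F (suc n)
      ≈⟨ +-congʳ (sumTo-cong n innerTerm) ⟩
    sumTo n F + F (suc n) ∎
    where
      g′ : ℕ → Carrier
      g′ = g ∘ suc
      A B E F : ℕ → Carrier
      A k = cGen g′ m₁ (n ∸ k)
      B k = cGen g′ m₁ (suc n ∸ k)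
      E k = cGen (shift (suc m₁) g) m₂ k
      F k = cGen g (suc m₁) (suc n ∸ k) * E k

      lastTerm : g 0 * (B (suc n) * E (suc n)) ≈ F (suc n)
      lastTerm rewrite ℕP.n∸n≡0 n = sym (*-assoc _ _ _)

      -- For k ≤ n, suc n ∸ k = suc (n ∸ k) and the recurrence of cGen applies.
      innerTerm : ∀ k → k ≤ n → A k * E k + g 0 * (B k * E k) ≈ F k
      innerTerm k k≤n rewrite ℕP.+-∸-assoc 1 k≤n =
        solve 4 (λ a x b e → a :* e :+ x :* (b :* e) := (a :+ x :* b) :* e)
              refl (A k) (g 0) (cGen g′ m₁ (suc (n ∸ k))) (E k)

  elem-vanish : ∀ t xs → length xs < t → elem t xs ≈ 0#
  elem-vanish (suc t) []       _           = refl
  elem-vanish (suc t) (x ∷ xs) (s≤s len<t) =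
    +-*-vanishing x (elem-vanish (suc t) xs (ℕP.m<n⇒m<1+n len<t)) (elem-vanish t xs len<t)

  elem≈cGen-+ : ∀ g t k → elem t (applyUpTo g (t ℕ.+ k)) ≈ cGen g (t ℕ.+ k) k
  elem≈cGen-+ g zero    zero    = refl
  elem≈cGen-+ g zero    (suc k) =
    sym (+-*-vanishing (g 0) (sym (elem≈cGen-+ (g ∘ suc) zero k)) (cGen-vanish (g ∘ suc) {k} ℕP.≤-refl))
  elem≈cGen-+ g (suc t) zero    =
    trans (+-cong (elem-vanish (suc t) (applyUpTo (g ∘ suc) (t ℕ.+ 0)) tooShort)
                  (*-congˡ (elem≈cGen-+ (g ∘ suc) t zero)))
          (+-identityˡ _)
    where
      tooShort : length (applyUpTo (g ∘ suc) (t ℕ.+ 0)) < suc t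
      tooShort = s≤s (ℕP.≤-reflexive (≡.trans (ListP.length-applyUpTo (g ∘ suc) (t ℕ.+ 0)) (ℕP.+-identityʳ t)))
  elem≈cGen-+ g (suc t) (suc k) = +-cong shifted (*-congˡ (elem≈cGen-+ (g ∘ suc) t (suc k)))
    where
      shifted : elem (suc t) (applyUpTo (g ∘ suc) (t ℕ.+ suc k)) ≈ cGen (g ∘ suc) (t ℕ.+ suc k) k
      shifted = ≡.subst (λ N → elem (suc t) (applyUpTo (g ∘ suc) N) ≈ cGen (g ∘ suc) N k)
                        (≡.sym (ℕP.+-suc t k)) (elem≈cGen-+ (g ∘ suc) (suc t) k)

  elem≈cGen : ∀ g {N k} → k ≤ N → elem (N ∸ k) (applyUpTo g N) ≈ cGen g N k
  elem≈cGen g {N} {k} k≤N =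
    ≡.subst (λ M → elem (N ∸ k) (applyUpTo g M) ≈ cGen g M k) (ℕP.m∸n+n≡m k≤N) (elem≈cGen-+ g (N ∸ k) k)

  -- SGen g N k = h_{N-k}(g 0, …, g k), and 0 for k > N; the recurrence is
  -- h_d(x, ys) = h_d(ys) + x · h_{d-1}(x, ys) read at lower index k = N - d.
  SGen : (ℕ → Carrier) → ℕ → ℕ → Carrier
  SGen g zero    zero    = 1#
  SGen g zero    (suc k) = 0#
  SGen g (suc N) zero    = g 0 * SGen g N zero
  SGen g (suc N) (suc k) = SGen (g ∘ suc) N k + g 0 * SGen g N (suc k)

  SGen-cong : ∀ {f g} → (∀ i → f i ≈ g i) → ∀ N k → SGen f N k ≈ SGen g N k
  SGen-cong f≈g zero    zero    = refl
  SGen-cong f≈g zero    (suc k) = refl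
  SGen-cong f≈g (suc N) zero    = *-cong (f≈g 0) (SGen-cong f≈g N zero)
  SGen-cong f≈g (suc N) (suc k) =
    +-cong (SGen-cong (f≈g ∘ suc) N k) (*-cong (f≈g 0) (SGen-cong f≈g N (suc k)))

  SGen-vanish : ∀ g {N k} → N < k → SGen g N k ≈ 0#
  SGen-vanish g {zero}  {suc k} _         = refl
  SGen-vanish g {suc N} {suc k} (s≤s N<k) =
    +-*-vanishing (g 0) (SGen-vanish (g ∘ suc) N<k) (SGen-vanish g (ℕP.m<n⇒m<1+n N<k))

  -- The first factor uses the weights g 0 … g j, the second g j … g n.
  SGen-convolution : ∀ g m₁ m₂ n →
    SGen g (m₁ ℕ.+ m₂) n ≈ sumTo n (λ j → SGen g m₁ j * SGen (shift j g) m₂ (n ∸ j))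
  SGen-convolution g zero m₂ n = sym (begin
    sumTo n (λ j → SGen g 0 j * SGen (shift j g) m₂ (n ∸ j))  ≈⟨ sumTo-first n _ (λ _ _ → zeroˡ _) ⟩
    1# * SGen g m₂ n                                           ≈⟨ *-identityˡ _ ⟩
    SGen g m₂ n                                                ∎)
  SGen-convolution g (suc m₁) m₂ zero =
    trans (*-congˡ (SGen-convolution g m₁ m₂ zero)) (sym (*-assoc _ _ _))
  SGen-convolution g (suc m₁) m₂ (suc n) = begin
    SGen g′ (m₁ ℕ.+ m₂) n + g 0 * SGen g (m₁ ℕ.+ m₂) (suc n)
      ≈⟨ +-cong (SGen-convolution g′ m₁ m₂ n)
                (*-congˡ (trans (SGen-convolution g m₁ m₂ (suc n)) (sumTo-head n _))) ⟩
    sumTo n (λ i → P i * Y i) + g 0 * (a * b + sumTo n (λ i → Q i * Y i))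
      ≈⟨ solve 5 (λ S x a b T → S :+ x :* (a :* b :+ T) := x :* a :* b :+ (S :+ x :* T))
               refl (sumTo n (λ i → P i * Y i)) (g 0) a b (sumTo n (λ i → Q i * Y i)) ⟩
    g 0 * a * b + (sumTo n (λ i → P i * Y i) + g 0 * sumTo n (λ i → Q i * Y i))
      ≈⟨ +-congˡ (sumTo-linear n (g 0) _ _) ⟩
    g 0 * a * b + sumTo n (λ i → P i * Y i + g 0 * (Q i * Y i))
      ≈⟨ +-congˡ (sumTo-cong n (λ i _ →
           solve 4 (λ p x q y → p :* y :+ x :* (q :* y) := (p :+ x :* q) :* y) refl (P i) (g 0) (Q i) (Y i))) ⟩
    g 0 * a * b + sumTo n (λ i → (P i + g 0 * Q i) * Y i)
      ≈⟨ sumTo-head n _ ⟨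
    sumTo (suc n) (λ j → SGen g (suc m₁) j * SGen (shift j g) m₂ (suc n ∸ j)) ∎
    where
      g′ : ℕ → Carrier
      g′ = g ∘ suc
      a b : Carrier
      a = SGen g m₁ 0
      b = SGen g m₂ (suc n)
      P Q Y : ℕ → Carrier
      P i = SGen g′ m₁ i
      Q i = SGen g m₁ (suc i)
      Y i = SGen (shift i g′) m₂ (n ∸ i)

  comp≈SGen-+ : ∀ g t k → comp t (applyUpTo g (suc k)) ≈ SGen g (t ℕ.+ k) k
  comp≈SGen-+ g zero    zero    = refl
  comp≈SGen-+ g zero    (suc k) =
    sym (+-*-vanishing (g 0) (sym (comp≈SGen-+ (g ∘ suc) zero k)) (SGen-vanish g {k} ℕP.≤-refl))
  comp≈SGen-+ g (suc t) zero    = trans (+-identityˡ _) (*-congˡ (comp≈SGen-+ g t zero))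
  comp≈SGen-+ g (suc t) (suc k) = +-cong shifted (*-congˡ (comp≈SGen-+ g t (suc k)))
    where
      shifted : comp (suc t) (applyUpTo (g ∘ suc) (suc k)) ≈ SGen (g ∘ suc) (t ℕ.+ suc k) k
      shifted = ≡.subst (λ N → comp (suc t) (applyUpTo (g ∘ suc) (suc k)) ≈ SGen (g ∘ suc) N k)
                        (≡.sym (ℕP.+-suc t k)) (comp≈SGen-+ (g ∘ suc) (suc t) k)

  comp≈SGen : ∀ g {N k} → k ≤ N → comp (N ∸ k) (applyUpTo g (suc k)) ≈ SGen g N k
  comp≈SGen g {N} {k} k≤N =
    ≡.subst (λ M → comp (N ∸ k) (applyUpTo g (suc k)) ≈ SGen g M k) (ℕP.m∸n+n≡m k≤N) (comp≈SGen-+ g (N ∸ k) k)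

  module StirlingWeights (v w : ℤ → Carrier) where

    cWeights : ℤ → ℤ → ℕ → ℕ → Carrier
    cWeights α β N i = v (α ℤ.+ (+ N) ℤ.- (+ 1) ℤ.- (+ i)) * w (β ℤ.+ (+ i))

    SWeights : ℤ → ℤ → ℕ → ℕ → Carrier
    SWeights α β k i = v (α ℤ.+ (+ k) ℤ.- (+ i)) * w (β ℤ.+ (+ i))

    cV≈cGen : ∀ α β N k → cV v w α β N k ≈ cGen (cWeights α β N) N k
    cV≈cGen α β N k with k ≤? N
    ... | yes k≤N = trans (reflexive (≡.cong (elem (N ∸ k)) (ListP.map-upTo (cWeights α β N) N)))
                          (elem≈cGen _ k≤N)
    ... | no  k≰N = sym (cGen-vanish _ (ℕP.≰⇒> k≰N))

    SV≈SGen : ∀ α β N k → SV v w α β N k ≈ SGen (SWeights α β k) N k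
    SV≈SGen α β N k with k ≤? N
    ... | yes k≤N = trans (reflexive (≡.cong (comp (N ∸ k)) (ListP.map-upTo (SWeights α β k) (suc k))))
                          (comp≈SGen _ k≤N)
    ... | no  k≰N = sym (SGen-vanish _ (ℕP.≰⇒> k≰N))

    cWeights-front : ∀ α β m₁ m₂ i → cWeights α β (m₁ ℕ.+ m₂) i ≡ cWeights (α ℤ.+ + m₂) β m₁ i
    cWeights-front α β m₁ m₂ i = ≡.cong (λ a → v a * w (β ℤ.+ + i))
      (≡.trans (≡.cong (λ x → α ℤ.+ x ℤ.- + 1 ℤ.- + i) (ℤP.pos-+ m₁ m₂)) (reorder α (+ m₁) (+ m₂) (+ i)))
      where
        reorder : ∀ a x y i → a ℤ.+ (x ℤ.+ y) ℤ.- + 1 ℤ.- i ≡ a ℤ.+ y ℤ.+ x ℤ.- + 1 ℤ.- i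
        reorder = solve-∀

    cWeights-back : ∀ α β m₁ m₂ i → cWeights α β (m₁ ℕ.+ m₂) (m₁ ℕ.+ i) ≡ cWeights α (β ℤ.+ + m₁) m₂ i
    cWeights-back α β m₁ m₂ i = ≡.cong₂ (λ a b → v a * w b)
      (≡.trans (≡.cong₂ (λ x y → α ℤ.+ x ℤ.- + 1 ℤ.- y) (ℤP.pos-+ m₁ m₂) (ℤP.pos-+ m₁ i))
               (cancel α (+ m₁) (+ m₂) (+ i)))
      (≡.trans (≡.cong (λ x → β ℤ.+ x) (ℤP.pos-+ m₁ i)) (≡.sym (ℤP.+-assoc β (+ m₁) (+ i))))
      where
        cancel : ∀ a x y i → a ℤ.+ (x ℤ.+ y) ℤ.- + 1 ℤ.- (x ℤ.+ i) ≡ a ℤ.+ y ℤ.- + 1 ℤ.- i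
        cancel = solve-∀

    SWeights-front : ∀ α β p q i → SWeights α β (p ℕ.+ q) i ≡ SWeights (α ℤ.+ + p) β q i
    SWeights-front α β p q i = ≡.cong (λ a → v a * w (β ℤ.+ + i))
      (≡.cong (λ x → x ℤ.- + i) (≡.trans (≡.cong (λ x → α ℤ.+ x) (ℤP.pos-+ p q)) (≡.sym (ℤP.+-assoc α (+ p) (+ q)))))

    SWeights-back : ∀ α β p q i → SWeights α β (p ℕ.+ q) (q ℕ.+ i) ≡ SWeights α (β ℤ.+ + q) p i
    SWeights-back α β p q i = ≡.cong₂ (λ a b → v a * w b)
      (≡.trans (≡.cong₂ (λ x y → α ℤ.+ x ℤ.- y) (ℤP.pos-+ p q) (ℤP.pos-+ q i)) (cancel α (+ p) (+ q) (+ i)))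
      (≡.trans (≡.cong (λ x → β ℤ.+ x) (ℤP.pos-+ q i)) (≡.sym (ℤP.+-assoc β (+ q) (+ i))))
      where
        cancel : ∀ a x y i → a ℤ.+ (x ℤ.+ y) ℤ.- (y ℤ.+ i) ≡ a ℤ.+ x ℤ.- i
        cancel = solve-∀

    cV-convolution : ∀ α β m₁ m₂ n →
      cV v w α β (m₁ ℕ.+ m₂) n ≈ sumTo n (λ k → cV v w (α ℤ.+ (+ m₂)) β m₁ (n ∸ k) * cV v w α (β ℤ.+ (+ m₁)) m₂ k)
    cV-convolution α β m₁ m₂ n = begin
      cV v w α β (m₁ ℕ.+ m₂) n                                      ≈⟨ cV≈cGen α β (m₁ ℕ.+ m₂) n ⟩
      cGen G (m₁ ℕ.+ m₂) n                                          ≈⟨ cGen-convolution G m₁ m₂ n ⟩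
      sumTo n (λ k → cGen G m₁ (n ∸ k) * cGen (shift m₁ G) m₂ k)   ≈⟨ sumTo-cong n (λ k _ → *-cong (front (n ∸ k)) (back k)) ⟩
      sumTo n (λ k → cV v w (α ℤ.+ (+ m₂)) β m₁ (n ∸ k) * cV v w α (β ℤ.+ (+ m₁)) m₂ k) ∎
      where
        G : ℕ → Carrier
        G = cWeights α β (m₁ ℕ.+ m₂)
        front : ∀ j → cGen G m₁ j ≈ cV v w (α ℤ.+ (+ m₂)) β m₁ j
        front j = trans (cGen-cong (reflexive ∘ cWeights-front α β m₁ m₂) m₁ j) (sym (cV≈cGen _ β m₁ j))
        back : ∀ k → cGen (shift m₁ G) m₂ k ≈ cV v w α (β ℤ.+ (+ m₁)) m₂ k
        back k = trans (cGen-cong (reflexive ∘ cWeights-back α β m₁ m₂) m₂ k) (sym (cV≈cGen α _ m₂ k))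

    -- The second identity: SGen-convolution, summed in reverse with k = n - j,
    -- and the weights split at k + (n ∸ k) = n.
    SV-convolution : ∀ α β m₁ m₂ n →
      SV v w α β (m₁ ℕ.+ m₂) n ≈ sumTo n (λ k → SV v w (α ℤ.+ (+ k)) β m₁ (n ∸ k) * SV v w α (β ℤ.+ (+ (n ∸ k))) m₂ k)
    SV-convolution α β m₁ m₂ n = begin
      SV v w α β (m₁ ℕ.+ m₂) n                 ≈⟨ SV≈SGen α β (m₁ ℕ.+ m₂) n ⟩
      SGen G (m₁ ℕ.+ m₂) n                     ≈⟨ SGen-convolution G m₁ m₂ n ⟩
      sumTo n U                                ≈⟨ sumTo-reverse n U ⟩
      sumTo n (λ k → U (n ∸ k))                ≈⟨ sumTo-cong n (λ k k≤n → *-cong (front k≤n) (back k≤n)) ⟩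
      sumTo n (λ k → SV v w (α ℤ.+ (+ k)) β m₁ (n ∸ k) * SV v w α (β ℤ.+ (+ (n ∸ k))) m₂ k) ∎
      where
        G U : ℕ → Carrier
        G = SWeights α β n
        U j = SGen G m₁ j * SGen (shift j G) m₂ (n ∸ j)

        split : ∀ {k} → k ≤ n → ∀ i → G i ≡ SWeights α β (k ℕ.+ (n ∸ k)) i
        split k≤n i = ≡.cong (λ N → SWeights α β N i) (≡.sym (ℕP.m+[n∸m]≡n k≤n))

        front : ∀ {k} → k ≤ n → SGen G m₁ (n ∸ k) ≈ SV v w (α ℤ.+ (+ k)) β m₁ (n ∸ k)
        front {k} k≤n = trans (SGen-cong (λ i → reflexive (≡.trans (split k≤n i) (SWeights-front α β k (n ∸ k) i))) m₁ (n ∸ k))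
                              (sym (SV≈SGen _ β m₁ (n ∸ k)))

        back : ∀ {k} → k ≤ n → SGen (shift (n ∸ k) G) m₂ (n ∸ (n ∸ k)) ≈ SV v w α (β ℤ.+ (+ (n ∸ k))) m₂ k
        back {k} k≤n = begin
          SGen (shift (n ∸ k) G) m₂ (n ∸ (n ∸ k))   ≈⟨ reflexive (≡.cong (SGen (shift (n ∸ k) G) m₂) (ℕP.m∸[m∸n]≡n k≤n)) ⟩
          SGen (shift (n ∸ k) G) m₂ k
            ≈⟨ SGen-cong (λ i → reflexive (≡.trans (split k≤n (n ∸ k ℕ.+ i)) (SWeights-back α β k (n ∸ k) i))) m₂ k ⟩
          SGen (SWeights α (β ℤ.+ (+ (n ∸ k))) k) m₂ k ≈⟨ SV≈SGen α _ m₂ k ⟨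
          SV v w α (β ℤ.+ (+ (n ∸ k))) m₂ k ∎

theorem6p1 : {c ℓ : Level} (K : CommutativeRing c ℓ) → let open CommutativeRing K in
    (v w : ℤ → Carrier) (α β : ℤ) (m₁ m₂ n : ℕ) →
      (VStirling.cV K v w α β (m₁ ℕ.+ m₂) n ≈ VStirling.sumTo K n (λ k → VStirling.cV K v w (α ℤ.+ (+ m₂)) β m₁ (n ∸ k) * VStirling.cV K v w α (β ℤ.+ (+ m₁)) m₂ k))
      × (VStirling.SV K v w α β (m₁ ℕ.+ m₂) n ≈ VStirling.sumTo K n (λ k → VStirling.SV K v w (α ℤ.+ (+ k)) β m₁ (n ∸ k) * VStirling.SV K v w α (β ℤ.+ (+ (n ∸ k))) m₂ k))
theorem6p1 K v w α β m₁ m₂ n = cV-convolution α β m₁ m₂ n , SV-convolution α β m₁ m₂ n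
  where open StirlingConvolution.StirlingWeights K v w
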